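{- Let $U$ be a linear numeration system satisfying (H1), (H2) and (H3), with recurrence $U_{i+k}=a_{k-1}U_{i+k-1}+\cdots+a_0U_i$ for all $i\ge N$. Let $p>\max\{|a_0|,U_N\}$ be a prime. If $X\subseteq\mathbb{N}$ is an ultimately periodic $U$-recognizable set with period $\pi_X=p^\mu\cdot r$ where $\mu\ge1$ and $r$ is not divisible by $p$, then the minimal automaton of $\operatorname{rep}_U(X)$ has at least $p^\mu$ states.
   Context: A numeration system is an increasing sequence $U=(U_i)_{i\ge0}$ of integers with $U_0=1$ such that $C_U=\sup_{i}\lceil U_{i+1}/U_i\rceil$ is finite; $A_U=\{0,\ldots,C_U-1\}$. For $n\ge1$, $\operatorname{rep}_U(n)=w_\ell\cdots w_0$ is the unique word over $A_U$ with $n=\sum w_iU_i$, $w_\ell\ne0$ and $\sum_{i=0}^t w_iU_i<U_{t+1}$ for $t=0,\ldots,\ell$; $\operatorname{rep}_U(0)$ is the empty word; $X$ is $U$-recognizable if $\operatorname{rep}_U(X)$ is regular. $U$ is linear if there exist $k\ge1$, integers $a_0\neq0,a_1,\ldots,a_{k-1}$ and $N\ge0$ with $U_{i+k}=a_{k-1}U_{i+k-1}+\cdots+a_0U_i$ for all $i\ge N$, where $k$ and then $N$ are chosen minimal. (H1): $\operatorname{rep}_U(\mathbb{N})$ is regular. (H2): $\limsup_{i}(U_{i+1}-U_i)=+\infty$. (H3): there is $G\ge0$ with $U_{i+1}-U_i\le U_{i+2}-U_{i+1}$ for all $i\ge G$. A set $X$ is ultimately periodic if its characteristic sequence is $uv^\omega$;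 with $u,v$ of minimal length, its period is $\pi_X=|v|$. -}

module Defs where

open import Data.Nat using (ℕ; zero; suc; _+_; _*_; _∸_; _≤_; _<_)
open import Data.Integer using (ℤ; +_; ∣_∣) renaming (_+_ to _+ℤ_; _*_ to _*ℤ_)
open import Data.Fin using (Fin; toℕ) renaming (zero to fzero; suc to fsuc)
open import Data.List using (List; []; _∷_; reverse; take; length)
open import Data.Bool using (Bool; true)
open import Data.Product using (Σ; _×_; ∃; ∃-syntax)
open import Relation.Nullary using (¬_)
open import Relation.Binary.PropositionalEquality using (_≡_; _≢_)

IsNumSys : (ℕ → ℕ) → Set
IsNumSys U = (U 0 ≡ 1) × (∀ i → U i < U (suc i))

-- C is exactly C_U = sup_i ⌈U(i+1)/U(i)⌉ (sup of a bounded set of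
-- naturals is attained):  ⌈a/b⌉ ≤ C  ⇔  a ≤ C*b,  and ⌈a/b⌉ = C for some i.
IsCU : (ℕ → ℕ) → ℕ → Set
IsCU U C = (∀ i → U (suc i) ≤ C * U i) × (∃[ i ] ((C ∸ 1) * U i < U (suc i)))

-- Words over the alphabet A_U = Fin C, written in reading order
-- w_ℓ ⋯ w_0 (most significant digit first).

valFrom : ∀ {C} → (ℕ → ℕ) → ℕ → List (Fin C) → ℕ
valFrom U i [] = 0
valFrom U i (d ∷ ds) = toℕ d * U i + valFrom U (suc i) ds

val : ∀ {C} → (ℕ → ℕ) → List (Fin C) → ℕ
val U w = valFrom U 0 (reverse w)

LeadingNonzero : ∀ {C} → List (Fin C) → Set
LeadingNonzero [] = Data.Unit.⊤
  where import Data.Unit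
LeadingNonzero (d ∷ _) = toℕ d ≢ 0

Greedy : ∀ {C} → (ℕ → ℕ) → List (Fin C) → Set
Greedy U w = ∀ t → t < length w → valFrom U 0 (take (suc t) (reverse w)) < U (suc t)

IsRep : ∀ {C} → (ℕ → ℕ) → ℕ → List (Fin C) → Set
IsRep U n w = (val U w ≡ n) × LeadingNonzero w × Greedy U w

RepLang : (C : ℕ) → (ℕ → ℕ) → (ℕ → Bool) → List (Fin C) → Set
RepLang C U X w = ∃[ n ] ((X n ≡ true) × IsRep U n w)

record DFA (C : ℕ) : Set where
  field
    states : ℕ
    δ      : Fin states → Fin C → Fin states
    start  : Fin states
    final  : Fin states → Bool

  run : Fin states → List (Fin C) → Fin states
  run q [] = q
  run q (a ∷ w) = run (δ q a) w

  Accepts : List (Fin C) → Set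
  Accepts w = final (run start w) ≡ true

Recognizes : ∀ {C} → DFA C → (List (Fin C) → Set) → Set
Recognizes M L = ∀ w → (DFA.Accepts M w → L w) × (L w → DFA.Accepts M w)

Regular : ∀ {C} → (List (Fin C) → Set) → Set
Regular {C} L = Σ (DFA C) λ M → Recognizes M L

-- the minimal automaton of L has at least m states:
-- every complete DFA recognizing L has at least m states
MinAutomatonAtLeast : ∀ {C} → (List (Fin C) → Set) → ℕ → Set
MinAutomatonAtLeast {C} L m = (M : DFA C) → Recognizes M L → m ≤ DFA.states M

Recognizable : (C : ℕ) → (ℕ → ℕ) → (ℕ → Bool) → Set
Recognizable C U X = Regular (RepLang C U X)

ΣFin : ∀ n → (Fin n → ℤ) → ℤ
ΣFin zero f = + 0
ΣFin (suc n) f = f fzero +ℤ ΣFin n (λ j → f (fsuc j))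

-- LinRec U k a N : U satisfies the recurrence of order (suc k)
--   U_{i+k+1} = a_k U_{i+k} + ⋯ + a_0 U_i   for all i ≥ N,  with a_0 ≠ 0.
LinRec : (ℕ → ℕ) → (k : ℕ) → (Fin (suc k) → ℤ) → ℕ → Set
LinRec U k a N =
  (a fzero ≢ + 0) ×
  (∀ i → N ≤ i → + U (i + suc k) ≡ ΣFin (suc k) (λ j → a j *ℤ + U (i + toℕ j)))

MinLinRec : (ℕ → ℕ) → (k : ℕ) → (Fin (suc k) → ℤ) → ℕ → Set
MinLinRec U k a N =
  LinRec U k a N ×
  (∀ k' → k' < k → ∀ (a' : Fin (suc k') → ℤ) N' → ¬ LinRec U k' a' N') ×
  (∀ N' → N' < N → ∀ (a' : Fin (suc k) → ℤ) → ¬ LinRec U k a' N')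

H1 : (C : ℕ) → (ℕ → ℕ) → Set
H1 C U = Regular (λ (w : List (Fin C)) → ∃[ n ] IsRep U n w)

H2 : (ℕ → ℕ) → Set
H2 U = ∀ M j → ∃[ i ] ((j ≤ i) × (M ≤ U (suc i) ∸ U i))

H3 : (ℕ → ℕ) → Set
H3 U = ∃[ G ] (∀ i → G ≤ i → U (suc i) ∸ U i ≤ U (suc (suc i)) ∸ U (suc i))

IsUltPeriod : (ℕ → Bool) → ℕ → Set
IsUltPeriod X π = (1 ≤ π) × (∃[ M ] (∀ n → M ≤ n → X (n + π) ≡ X n))

HasPeriod : (ℕ → Bool) → ℕ → Set
HasPeriod X π = IsUltPeriod X π × (∀ π' → π' < π → ¬ IsUltPeriod X π')

module Submission where

-- Modulo q = p ^ μ the recurrence makes U ultimately periodic: a window of k + 1 consecutive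
-- residues determines the next one, and there are only q ^ (k + 1) windows.  Some U i* in a window
-- of that periodic part is prime to p, for otherwise the recurrence with p ∤ a₀ pushes divisibility
-- by p down to the window starting at N, yet 0 < U N < p.  By (H2) and (H3) the gaps U (i+1) − U i
-- eventually exceed any bound, so a 1 can be placed at positions i* + T m far enough apart that all
-- words stay greedy; the high parts w₁, …, w_q obtained have values v_c ≡ c · U i* (mod q).  If two
-- of them lead a DFA for rep_U(X) to the same state, X agrees on v_c + t and v_c′ + t for all t,
-- so π divides v_c′ − v_c, whence q ∣ (c′ − c) · U i* and q ∣ c′ − c, impossible for 0 < c′ − c < q.

open import Defs
open import Data.Nat using (ℕ; zero; suc; _+_; _*_; _∸_; _^_; _⊔_; _≤_; _<_; z≤n; s≤s; NonZero; >-nonZero)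
open import Data.Nat.Properties
open import Data.Nat.DivMod using (_%_; _/_; _mod_; m≡m%n+[m/n]*n; m%n<n; m<n*o⇒m/o<n)
import Data.Nat.Divisibility as ℕ∣
open import Data.Nat.Divisibility using (_∣_)
open import Data.Integer as ℤ using (ℤ; +_; ∣_∣)
import Data.Integer.Properties as ℤ
open import Data.Integer.Divisibility.Signed as ℤ∣
  using (divides; ∣m⇒∣-m; ∣m∣n⇒∣m+n; ∣n⇒∣m*n; ∣m+n∣n⇒∣m; ∣⇒∣ᵤ; ∣ᵤ⇒∣)
open import Data.Integer.Tactic.RingSolver using (solve-∀)
open import Data.Fin using (Fin; toℕ; fromℕ<; combine) renaming (zero to fzero; suc to fsuc)
open import Data.Fin.Properties using (toℕ-fromℕ<; toℕ<n; combine-injective; pigeonhole; any?)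
open import Data.Product using (Σ; _×_; _,_; proj₁; proj₂; ∃; ∃-syntax; swap)
open import Data.Sum using (inj₁; inj₂)
open import Data.Empty using (⊥-elim)
open import Relation.Nullary using (¬_; yes; no; ¬?; contradiction)
open import Relation.Nullary.Decidable using (decidable-stable)
open import Data.Nat.Primality using (Prime; euclidsLemma; prime⇒nonZero)
open import Data.List using (List; []; _∷_; _++_; reverse; take; length; replicate; [_])
open import Data.List.Properties using (reverse-involutive; reverse-++; length-reverse; length-++; ++-assoc)
open import Data.Unit using (⊤; tt)
open import Data.Bool using (Bool; true; false)
open import Relation.Binary.PropositionalEquality hiding ([_])

infix 4 _≡_[mod_]

record _≡_[mod_] (x y : ℤ) (q : ℕ) : Set where
  constructor mod-witness
  field
    divides-difference : + q ℤ∣.∣ x ℤ.- y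

module _ {q : ℕ} where

  private
    x-x≡0 : ∀ x → x ℤ.- x ≡ + 0 ℤ.* + q
    x-x≡0 x = trans (ℤ.+-inverseʳ x) (sym (ℤ.*-zeroˡ (+ q)))
    neg-diff : ∀ x y → ℤ.- (x ℤ.- y) ≡ y ℤ.- x
    neg-diff = solve-∀
    diff-trans : ∀ x y z → (x ℤ.- y) ℤ.+ (y ℤ.- z) ≡ x ℤ.- z
    diff-trans = solve-∀
    diff-+ : ∀ x y z w → (x ℤ.- y) ℤ.+ (z ℤ.- w) ≡ (x ℤ.+ z) ℤ.- (y ℤ.+ w)
    diff-+ = solve-∀
    diff-* : ∀ a x y → a ℤ.* (x ℤ.- y) ≡ a ℤ.* x ℤ.- a ℤ.* y
    diff-* = solve-∀

  ≡-mod-refl : ∀ {x} → x ≡ x [mod q ]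
  ≡-mod-refl {x} = mod-witness (divides (+ 0) (x-x≡0 x))

  ≡-mod-reflexive : ∀ {x y} → x ≡ y → x ≡ y [mod q ]
  ≡-mod-reflexive refl = ≡-mod-refl

  ≡-mod-sym : ∀ {x y} → x ≡ y [mod q ] → y ≡ x [mod q ]
  ≡-mod-sym {x} {y} (mod-witness d) = mod-witness (subst (+ q ℤ∣.∣_) (neg-diff x y) (∣m⇒∣-m d))

  ≡-mod-trans : ∀ {x y z} → x ≡ y [mod q ] → y ≡ z [mod q ] → x ≡ z [mod q ]
  ≡-mod-trans {x} {y} {z} (mod-witness d) (mod-witness e) =
    mod-witness (subst (+ q ℤ∣.∣_) (diff-trans x y z) (∣m∣n⇒∣m+n d e))

  +-cong-mod : ∀ {x y z w} → x ≡ y [mod q ] → z ≡ w [mod q ] → x ℤ.+ z ≡ y ℤ.+ w [mod q ]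
  +-cong-mod {x} {y} {z} {w} (mod-witness d) (mod-witness e) =
    mod-witness (subst (+ q ℤ∣.∣_) (diff-+ x y z w) (∣m∣n⇒∣m+n d e))

  *-congˡ-mod : ∀ a {x y} → x ≡ y [mod q ] → a ℤ.* x ≡ a ℤ.* y [mod q ]
  *-congˡ-mod a {x} {y} (mod-witness d) = mod-witness (subst (+ q ℤ∣.∣_) (diff-* a x y) (∣n⇒∣m*n a d))

  ΣFin-cong-mod : ∀ n {f g : Fin n → ℤ} → (∀ j → f j ≡ g j [mod q ]) → ΣFin n f ≡ ΣFin n g [mod q ]
  ΣFin-cong-mod zero fg = ≡-mod-refl
  ΣFin-cong-mod (suc n) fg = +-cong-mod (fg fzero) (ΣFin-cong-mod n (λ j → fg (fsuc j)))

  private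
    +[m+d]-+m≡+d : ∀ m d → + (m + d) ℤ.- + m ≡ + d
    +[m+d]-+m≡+d m d = trans (cong (ℤ._- + m) (ℤ.pos-+ m d)) (cancel (+ m) (+ d))
      where
      cancel : ∀ x y → (x ℤ.+ y) ℤ.- x ≡ y
      cancel = solve-∀

  ∣⇒+-≡-mod : ∀ m {d} → q ∣ d → + (m + d) ≡ + m [mod q ]
  ∣⇒+-≡-mod m {d} q∣d = mod-witness (subst (+ q ℤ∣.∣_) (sym (+[m+d]-+m≡+d m d)) (∣ᵤ⇒∣ q∣d))

  +-≡-mod⇒∣ : ∀ m {d} → + (m + d) ≡ + m [mod q ] → q ∣ d
  +-≡-mod⇒∣ m {d} (mod-witness e) = ∣⇒∣ᵤ (subst (+ q ℤ∣.∣_) (+[m+d]-+m≡+d m d) e)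

  %-≡⇒≡-mod : .{{_ : NonZero q}} → ∀ m n → m % q ≡ n % q → + m ≡ + n [mod q ]
  %-≡⇒≡-mod m n eq = mod-witness (divides (+ (m / q) ℤ.- + (n / q)) (begin
      + m ℤ.- + n
    ≡⟨ cong₂ ℤ._-_ (split m) (trans (split n) (cong (λ r → + r ℤ.+ + (n / q) ℤ.* + q) (sym eq))) ⟩
      (+ (m % q) ℤ.+ + (m / q) ℤ.* + q) ℤ.- (+ (m % q) ℤ.+ + (n / q) ℤ.* + q)
    ≡⟨ factor (+ (m % q)) (+ (m / q)) (+ (n / q)) (+ q) ⟩
      (+ (m / q) ℤ.- + (n / q)) ℤ.* + q ∎))
    where
    open ≡-Reasoning
    split : ∀ m → + m ≡ + (m % q) ℤ.+ + (m / q) ℤ.* + q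
    split m = trans (cong +_ (m≡m%n+[m/n]*n m q))
      (trans (ℤ.pos-+ (m % q) (m / q * q)) (cong (λ z → + (m % q) ℤ.+ z) (ℤ.pos-* (m / q) q)))
    factor : ∀ r a b c → (r ℤ.+ a ℤ.* c) ℤ.- (r ℤ.+ b ℤ.* c) ≡ (a ℤ.- b) ℤ.* c
    factor = solve-∀

residueWindow : (q : ℕ) .{{_ : NonZero q}} (f : ℕ → ℕ) (n x : ℕ) → Fin (q ^ n)
residueWindow q f zero x = fzero
residueWindow q f (suc n) x = combine (f x mod q) (residueWindow q f n (suc x))

residueWindow-injective : ∀ q .{{_ : NonZero q}} f n {x y} → residueWindow q f n x ≡ residueWindow q f n y →
                          ∀ j → j < n → f (x + j) % q ≡ f (y + j) % q
residueWindow-injective q f (suc n) {x} {y} eq j j<n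
  with combine-injective (f x mod q) (residueWindow q f n (suc x)) (f y mod q) (residueWindow q f n (suc y)) eq
residueWindow-injective q f (suc n) {x} {y} eq zero _ | head-eq , _ =
  subst₂ (λ u v → f u % q ≡ f v % q) (sym (+-identityʳ x)) (sym (+-identityʳ y))
    (trans (sym (toℕ-fromℕ< (m%n<n (f x) q))) (trans (cong toℕ head-eq) (toℕ-fromℕ< (m%n<n (f y) q))))
residueWindow-injective q f (suc n) {x} {y} eq (suc j) (s≤s j<n) | _ , tail-eq =
  subst₂ (λ u v → f u % q ≡ f v % q) (sym (+-suc x j)) (sym (+-suc y j))
    (residueWindow-injective q f n tail-eq j j<n)

periodic-mod-* : ∀ {q} {f : ℕ → ℕ} {i₀ T} → (∀ i → i₀ ≤ i → + f (i + T) ≡ + f i [mod q ]) →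
                 ∀ {i} → i₀ ≤ i → ∀ m → + f (i + T * m) ≡ + f i [mod q ]
periodic-mod-* {f = f} {T = T} periodic {i} _ zero =
  ≡-mod-reflexive (cong (λ x → + f x) (trans (cong (_+_ i) (*-zeroʳ T)) (+-identityʳ i)))
periodic-mod-* {q} {f} {i₀} {T} periodic {i} i₀≤i (suc m) = ≡-mod-trans
  (subst (λ x → + f x ≡ + f (i + T * m) [mod q ]) i+T[1+m]≡ (periodic (i + T * m) (≤-trans i₀≤i (m≤m+n i _))))
  (periodic-mod-* periodic i₀≤i m)
  where
  i+T[1+m]≡ : i + T * m + T ≡ i + T * suc m
  i+T[1+m]≡ = trans (+-assoc i _ T) (cong (_+_ i) (trans (+-comm _ T) (sym (*-suc T m))))

0<n<p⇒p∤n : ∀ {p n} → 0 < n → n < p → ¬ p ∣ n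
0<n<p⇒p∤n {n = suc _} _ n<p p∣n = <⇒≱ n<p (ℕ∣.∣⇒≤ p∣n)

prime^-∣-cancelʳ : ∀ {p} → Prime p → ∀ μ {m n} → ¬ p ∣ n → p ^ μ ∣ m * n → p ^ μ ∣ m
prime^-∣-cancelʳ p-prime zero {m} _ _ = ℕ∣.1∣ m
prime^-∣-cancelʳ {p} p-prime (suc μ) {m} {n} p∤n p^μ+1∣mn
  with euclidsLemma m n p-prime (ℕ∣.∣-trans (ℕ∣.m∣m*n (p ^ μ)) p^μ+1∣mn)
... | inj₂ p∣n = contradiction p∣n p∤n
... | inj₁ (ℕ∣.divides m′ refl) = subst (λ x → p * p ^ μ ∣ x) (*-comm p m′)
  (ℕ∣.*-monoʳ-∣ p (prime^-∣-cancelʳ p-prime μ p∤n (ℕ∣.*-cancelˡ-∣ p {{prime⇒nonZero p-prime}}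
    (subst (λ x → p * p ^ μ ∣ x) (trans (cong (_* n) (*-comm m′ p)) (*-assoc p m′ n)) p^μ+1∣mn))))

∣-ΣFin : ∀ {d} n (f : Fin n → ℤ) → (∀ j → d ℤ∣.∣ f j) → d ℤ∣.∣ ΣFin n f
∣-ΣFin {d} zero f _ = divides (+ 0) (sym (ℤ.*-zeroˡ d))
∣-ΣFin (suc n) f d∣f = ∣m∣n⇒∣m+n (d∣f fzero) (∣-ΣFin n (λ j → f (fsuc j)) (λ j → d∣f (fsuc j)))

module Recurrence {U : ℕ → ℕ} {k : ℕ} {a : Fin (suc k) → ℤ} {N : ℕ} (rec : LinRec U k a N) where

  WindowsCongruent : ℕ → ℕ → ℕ → Set
  WindowsCongruent q x y = ∀ j → j ≤ k → + U (x + j) ≡ + U (y + j) [mod q ]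

  windowsCongruent-suc : ∀ {q x y} → N ≤ x → N ≤ y → WindowsCongruent q x y → WindowsCongruent q (suc x) (suc y)
  windowsCongruent-suc {q} {x} {y} N≤x N≤y w j j≤k =
    subst₂ (λ u v → + U u ≡ + U v [mod q ]) (+-suc x j) (+-suc y j) (next j≤k)
    where
    next : j ≤ k → + U (x + suc j) ≡ + U (y + suc j) [mod q ]
    next j≤k with m≤n⇒m<n∨m≡n j≤k
    ... | inj₁ j<k = w (suc j) j<k
    ... | inj₂ refl = subst₂ _≡_[mod q ] (sym (proj₂ rec x N≤x)) (sym (proj₂ rec y N≤y))
      (ΣFin-cong-mod (suc k) (λ i → *-congˡ-mod (a i) (w (toℕ i) (≤-pred (toℕ<n i)))))

  windowsCongruent-+ : ∀ {q x y} → N ≤ x → N ≤ y → WindowsCongruent q x y →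
                       ∀ m → WindowsCongruent q (m + x) (m + y)
  windowsCongruent-+ N≤x N≤y w zero = w
  windowsCongruent-+ {x = x} {y} N≤x N≤y w (suc m) = windowsCongruent-suc
    (≤-trans N≤x (m≤n+m x m)) (≤-trans N≤y (m≤n+m y m)) (windowsCongruent-+ N≤x N≤y w m)

  eventually-periodic-mod : ∀ q .{{_ : NonZero q}} →
    ∃[ i₀ ] ∃[ T ] (N ≤ i₀) × (1 ≤ T) × (∀ i → i₀ ≤ i → + U (i + T) ≡ + U i [mod q ])
  eventually-periodic-mod q
    with pigeonhole (n<1+n (q ^ suc k)) (λ x → residueWindow q U (suc k) (N + toℕ x))
  ... | s , t , s<t , eq = i₀ , T , N≤i₀ , m<n⇒0<n∸m s<t , periodic
    where
    T = toℕ t ∸ toℕ s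
    i₀ = N + toℕ s
    N≤i₀ : N ≤ i₀
    N≤i₀ = m≤m+n N (toℕ s)
    N+t≡i₀+T : N + toℕ t ≡ i₀ + T
    N+t≡i₀+T = trans (cong (_+_ N) (sym (m+[n∸m]≡n (<⇒≤ s<t)))) (sym (+-assoc N (toℕ s) T))
    window : WindowsCongruent q i₀ (i₀ + T)
    window j j≤k = subst (λ y → + U (i₀ + j) ≡ + U (y + j) [mod q ]) N+t≡i₀+T
      (%-≡⇒≡-mod _ _ (residueWindow-injective q U (suc k) eq j (s≤s j≤k)))
    periodic : ∀ i → i₀ ≤ i → + U (i + T) ≡ + U i [mod q ]
    periodic i i₀≤i = subst₂ (λ u v → + U v ≡ + U u [mod q ]) shifted shifted+T
      (≡-mod-sym (windowsCongruent-+ N≤i₀ (≤-trans N≤i₀ (m≤m+n i₀ T)) window (i ∸ i₀) 0 z≤n))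
      where
      shifted : i ∸ i₀ + i₀ + 0 ≡ i
      shifted = trans (+-identityʳ _) (m∸n+n≡m i₀≤i)
      shifted+T : i ∸ i₀ + (i₀ + T) + 0 ≡ i + T
      shifted+T = trans (+-identityʳ _) (trans (sym (+-assoc (i ∸ i₀) i₀ T)) (cong (_+ T) (m∸n+n≡m i₀≤i)))

  module _ {p : ℕ} (p-prime : Prime p) (∣a₀∣<p : ∣ a fzero ∣ < p) (0<U[N] : 0 < U N) (U[N]<p : U N < p) where

    WindowDivisible : ℕ → Set
    WindowDivisible i = ∀ j → j ≤ k → p ∣ U (i + j)

    windowDivisible-pred : ∀ {i} → N ≤ i → WindowDivisible (suc i) → WindowDivisible i
    windowDivisible-pred {i} N≤i div (suc j) j<k = subst (λ x → p ∣ U x) (sym (+-suc i j)) (div j (<⇒≤ j<k))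
    windowDivisible-pred {i} N≤i div zero _ with euclidsLemma ∣ a fzero ∣ (U (i + 0)) p-prime p∣a₀U
      where
      p∣ : ∀ j → j ≤ k → + p ℤ∣.∣ + U (i + suc j)
      p∣ j j≤k = ∣ᵤ⇒∣ (subst (λ x → p ∣ U x) (sym (+-suc i j)) (div j j≤k))
      p∣a₀U : p ∣ (∣ a fzero ∣ * U (i + 0))
      p∣a₀U = subst (p ∣_) (ℤ.abs-* (a fzero) (+ U (i + 0))) (∣⇒∣ᵤ (∣m+n∣n⇒∣m {m = a fzero ℤ.* + U (i + 0)}
        (subst (+ p ℤ∣.∣_) (proj₂ rec i N≤i) (p∣ k ≤-refl))
        (∣-ΣFin k _ (λ j → ∣n⇒∣m*n (a (fsuc j)) (p∣ (toℕ j) (<⇒≤ (toℕ<n j)))))))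
    ... | inj₂ p∣U = p∣U
    ... | inj₁ p∣a₀ = ⊥-elim (0<n<p⇒p∤n 0<∣a₀∣ ∣a₀∣<p p∣a₀)
      where
      0<∣a₀∣ : 0 < ∣ a fzero ∣
      0<∣a₀∣ = n≢0⇒n>0 (λ ∣a₀∣≡0 → proj₁ rec (ℤ.∣i∣≡0⇒i≡0 ∣a₀∣≡0))

    ¬windowDivisible : ∀ e → ¬ WindowDivisible (N + e)
    ¬windowDivisible zero div =
      0<n<p⇒p∤n 0<U[N] U[N]<p (subst (λ x → p ∣ U x) (trans (+-identityʳ _) (+-identityʳ N)) (div 0 z≤n))
    ¬windowDivisible (suc e) div =
      ¬windowDivisible e (windowDivisible-pred (m≤m+n N e) (subst WindowDivisible (+-suc N e) div))

    window-has-nondivisible : ∀ i → N ≤ i → ∃[ j ] (j ≤ k) × ¬ p ∣ U (i + j)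
    window-has-nondivisible i N≤i with any? (λ (j : Fin (suc k)) → ¬? (p ℕ∣.∣? U (i + toℕ j)))
    ... | yes (j , p∤) = toℕ j , ≤-pred (toℕ<n j) , p∤
    ... | no none = ⊥-elim (¬windowDivisible (i ∸ N) (subst WindowDivisible (sym (m+[n∸m]≡n N≤i)) all-divisible))
      where
      all-divisible : WindowDivisible i
      all-divisible j j≤k = decidable-stable (p ℕ∣.∣? U (i + j)) λ p∤ →
        none (fromℕ< (s≤s j≤k) , subst (λ x → ¬ p ∣ U (i + x)) (sym (toℕ-fromℕ< (s≤s j≤k))) p∤)

    nondivisible-periodic-progression : ∀ μ →
      ∃[ i* ] ∃[ T ] (1 ≤ T) × ¬ p ∣ U i* × (∀ m → + U (i* + T * m) ≡ + U i* [mod p ^ μ ])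
    nondivisible-periodic-progression μ =
      progression (eventually-periodic-mod (p ^ μ) {{m^n≢0 p μ {{prime⇒nonZero p-prime}}}})
      where
      progression : ∃[ i₀ ] ∃[ T ] (N ≤ i₀) × (1 ≤ T) × (∀ i → i₀ ≤ i → + U (i + T) ≡ + U i [mod p ^ μ ]) →
                    ∃[ i* ] ∃[ T ] (1 ≤ T) × ¬ p ∣ U i* × (∀ m → + U (i* + T * m) ≡ + U i* [mod p ^ μ ])
      progression (i₀ , T , N≤i₀ , 1≤T , periodic) =
        let (j , _ , p∤U[i₀+j]) = window-has-nondivisible i₀ N≤i₀
        in i₀ + j , T , 1≤T , p∤U[i₀+j] , periodic-mod-* periodic (m≤m+n i₀ j)

PeriodicFrom : (ℕ → Bool) → ℕ → ℕ → Set
PeriodicFrom X M π = ∀ n → M ≤ n → X (n + π) ≡ X n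

module _ {X : ℕ → Bool} {M π : ℕ} (periodic : PeriodicFrom X M π) where

  periodicFrom-* : ∀ n m → M ≤ n → X (n + m * π) ≡ X n
  periodicFrom-* n zero _ = cong X (+-identityʳ n)
  periodicFrom-* n (suc m) M≤n = begin
      X (n + (π + m * π))
    ≡⟨ cong X (trans (cong (_+_ n) (+-comm π (m * π))) (sym (+-assoc n (m * π) π))) ⟩
      X (n + m * π + π)
    ≡⟨ periodic (n + m * π) (≤-trans M≤n (m≤m+n n _)) ⟩
      X (n + m * π)
    ≡⟨ periodicFrom-* n m M≤n ⟩
      X n ∎
    where open ≡-Reasoning

  periodicFrom-% : .{{_ : NonZero π}} → ∀ n t → M ≤ n → X (n + t) ≡ X (n + t % π)
  periodicFrom-% n t M≤n = trans (cong X (trans (cong (_+_ n) (m≡m%n+[m/n]*n t π)) (sym (+-assoc n (t % π) _))))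
    (periodicFrom-* (n + t % π) (t / π) (≤-trans M≤n (m≤m+n n _)))

  agree-below-period⇒agree : .{{_ : NonZero π}} → ∀ {a b} → M ≤ a → M ≤ b →
                             (∀ t → t < π → X (a + t) ≡ X (b + t)) → ∀ t → X (a + t) ≡ X (b + t)
  agree-below-period⇒agree {a} {b} M≤a M≤b agree t = begin
      X (a + t)         ≡⟨ periodicFrom-% a t M≤a ⟩
      X (a + t % π)     ≡⟨ agree (t % π) (m%n<n t π) ⟩
      X (b + t % π)     ≡⟨ sym (periodicFrom-% b t M≤b) ⟩
      X (b + t)         ∎
    where open ≡-Reasoning

shifted-copy⇒periodicFrom : ∀ {X : ℕ → Bool} a d → (∀ t → X (a + t) ≡ X (a + d + t)) → PeriodicFrom X a d
shifted-copy⇒periodicFrom {X} a d copy n a≤n = begin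
    X (n + d)                ≡⟨ cong X (trans (cong (_+ d) (sym (m+[n∸m]≡n a≤n))) (reorder a (n ∸ a) d)) ⟩
    X (a + d + (n ∸ a))      ≡⟨ sym (copy (n ∸ a)) ⟩
    X (a + (n ∸ a))          ≡⟨ cong X (m+[n∸m]≡n a≤n) ⟩
    X n                      ∎
  where
  open ≡-Reasoning
  reorder : ∀ x y z → x + y + z ≡ x + z + y
  reorder x y z = trans (+-assoc x y z) (trans (cong (_+_ x) (+-comm y z)) (sym (+-assoc x z y)))

minimal-period-∣ : ∀ {X π} → HasPeriod X π → ∀ {a d} → PeriodicFrom X a d → π ∣ d
minimal-period-∣ {X} {π} ((1≤π , M , periodic) , minimal) {a} {d} periodic-d = ℕ∣.m%n≡0⇒n∣m d π remainder≡0
  where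
  instance
    π≢0 : NonZero π
    π≢0 = >-nonZero 1≤π
  remainder-periodic : PeriodicFrom X (a ⊔ M) (d % π)
  remainder-periodic n a⊔M≤n = begin
      X (n + d % π)
    ≡⟨ sym (periodicFrom-* periodic (n + d % π) (d / π) (≤-trans (m≤n⊔m a M) (≤-trans a⊔M≤n (m≤m+n n _)))) ⟩
      X (n + d % π + d / π * π)
    ≡⟨ cong X (trans (+-assoc n (d % π) _) (cong (_+_ n) (sym (m≡m%n+[m/n]*n d π)))) ⟩
      X (n + d)
    ≡⟨ periodic-d n (≤-trans (m≤m⊔n a M) a⊔M≤n) ⟩
      X n ∎
    where open ≡-Reasoning
  remainder≡0 : d % π ≡ 0
  remainder≡0 with d % π in eq
  ... | zero = refl
  ... | suc _ = ⊥-elim (minimal (d % π) (m%n<n d π) (subst (1 ≤_) (sym eq) (s≤s z≤n) , a ⊔ M , remainder-periodic))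

monotoneFrom-≤ : ∀ {f : ℕ → ℕ} {G} → (∀ i → G ≤ i → f i ≤ f (suc i)) → ∀ {i j} → G ≤ i → i ≤ j → f i ≤ f j
monotoneFrom-≤ {f} mono {i} {j} G≤i i≤j = subst (λ x → f i ≤ f x) (m+[n∸m]≡n i≤j) (go (j ∸ i))
  where
  go : ∀ e → f i ≤ f (i + e)
  go zero = ≤-reflexive (cong f (sym (+-identityʳ i)))
  go (suc e) = ≤-trans (go e)
    (subst (λ x → f (i + e) ≤ f x) (sym (+-suc i e)) (mono (i + e) (≤-trans G≤i (m≤m+n i e))))

gaps-eventually-≥ : ∀ {U} → H2 U → H3 U → ∀ D → ∃[ B ] ∀ i → B ≤ i → D ≤ U (suc i) ∸ U i
gaps-eventually-≥ {U} unbounded (G , gaps-monotone) D with unbounded D G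
... | i₀ , G≤i₀ , D≤gap = i₀ , λ i i₀≤i → ≤-trans D≤gap (monotoneFrom-≤ gaps-monotone G≤i₀ i₀≤i)

i<U[i] : ∀ {U} → IsNumSys U → ∀ i → i < U i
i<U[i] (U₀≡1 , _) zero = subst (0 <_) (sym U₀≡1) (s≤s z≤n)
i<U[i] numsys@(_ , increasing) (suc i) = ≤-trans (s≤s (i<U[i] numsys i)) (increasing i)

module Greedy (U : ℕ → ℕ) where

  -- The digits ds, least significant first, sit at positions i, i+1, … above lower digits of value s.
  GreedyFrom : ∀ {C} → ℕ → ℕ → List (Fin C) → Set
  GreedyFrom i s [] = ⊤
  GreedyFrom i s (d ∷ ds) = (s + toℕ d * U i < U (suc i)) × GreedyFrom (suc i) (s + toℕ d * U i) ds

  greedyFrom-take : ∀ {C} i s (ds : List (Fin C)) → GreedyFrom i s ds →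
                    ∀ t → t < length ds → s + valFrom U i (take (suc t) ds) < U (i + suc t)
  greedyFrom-take i s (d ∷ ds) (lt , _) zero _ =
    subst₂ _<_ (cong (_+_ s) (sym (+-identityʳ _))) (cong U (sym (trans (+-suc i 0) (cong suc (+-identityʳ i))))) lt
  greedyFrom-take i s (d ∷ ds) (_ , g) (suc t) (s≤s t<) =
    subst₂ _<_ (+-assoc s _ _) (cong U (sym (+-suc i (suc t)))) (greedyFrom-take (suc i) _ ds g t t<)

  greedyFrom⇒Greedy : ∀ {C} (ds : List (Fin C)) → GreedyFrom 0 0 ds → Greedy U (reverse ds)
  greedyFrom⇒Greedy ds g t t< = subst (λ w → valFrom U 0 (take (suc t) w) < U (suc t)) (sym (reverse-involutive ds))
    (greedyFrom-take 0 0 ds g t (subst (t <_) (length-reverse ds) t<))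

  valFrom-++ : ∀ {C} i (xs ys : List (Fin C)) → valFrom U i (xs ++ ys) ≡ valFrom U i xs + valFrom U (i + length xs) ys
  valFrom-++ i [] ys = cong (λ j → valFrom U j ys) (sym (+-identityʳ i))
  valFrom-++ i (d ∷ xs) ys = begin
      toℕ d * U i + valFrom U (suc i) (xs ++ ys)
    ≡⟨ cong (_+_ (toℕ d * U i)) (valFrom-++ (suc i) xs ys) ⟩
      toℕ d * U i + (valFrom U (suc i) xs + valFrom U (suc i + length xs) ys)
    ≡⟨ sym (+-assoc (toℕ d * U i) _ _) ⟩
      toℕ d * U i + valFrom U (suc i) xs + valFrom U (suc i + length xs) ys
    ≡⟨ cong (λ j → toℕ d * U i + valFrom U (suc i) xs + valFrom U j ys) (sym (+-suc i (length xs))) ⟩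
      toℕ d * U i + valFrom U (suc i) xs + valFrom U (i + suc (length xs)) ys ∎
    where open ≡-Reasoning

  greedyFrom-++ : ∀ {C} i s (xs ys : List (Fin C)) → GreedyFrom i s xs →
                  GreedyFrom (i + length xs) (s + valFrom U i xs) ys → GreedyFrom i s (xs ++ ys)
  greedyFrom-++ i s [] ys _ g = subst₂ (λ j v → GreedyFrom j v ys) (+-identityʳ i) (+-identityʳ s) g
  greedyFrom-++ i s (d ∷ xs) ys (lt , gx) gy = lt , greedyFrom-++ (suc i) _ xs ys gx
    (subst₂ (λ j v → GreedyFrom j v ys) (+-suc i (length xs)) (sym (+-assoc s _ _)) gy)

  block : ∀ {C} → ℕ → List (Fin (suc (suc C)))
  block g = replicate g fzero ++ [ fsuc fzero ]

  length-block : ∀ {C} g → length (block {C} g) ≡ suc g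
  length-block zero = refl
  length-block (suc g) = cong suc (length-block g)

  valFrom-block : ∀ {C} i g → valFrom U i (block {C} g) ≡ U (i + g)
  valFrom-block i zero = trans (+-identityʳ _) (trans (+-identityʳ (U i)) (cong U (sym (+-identityʳ i))))
  valFrom-block i (suc g) = trans (valFrom-block (suc i) g) (cong U (sym (+-suc i g)))

  greedyFrom-block : ∀ {C} → (∀ j → U j < U (suc j)) → ∀ i s g → s < U i → s + U (i + g) < U (suc (i + g)) →
                     GreedyFrom i s (block {C} g)
  greedyFrom-block _ i s zero _ lt =
    subst₂ (λ x j → s + x < U (suc j)) (trans (cong U (+-identityʳ i)) (sym (+-identityʳ (U i)))) (+-identityʳ i) lt , tt
  greedyFrom-block increasing i s (suc g) s<U lt = s+0<U , greedyFrom-block increasing (suc i) (s + 0) g s+0<U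
    (subst₂ (λ x j → x + U j < U (suc j)) (sym (+-identityʳ s)) (+-suc i g) lt)
    where
    s+0<U : s + 0 < U (suc i)
    s+0<U = subst (_< U (suc i)) (sym (+-identityʳ s)) (<-trans s<U (increasing i))

  leadingNonzero-block : ∀ {C} (ds : List (Fin (suc (suc C)))) g → LeadingNonzero (reverse (ds ++ block g))
  leadingNonzero-block ds g = subst LeadingNonzero (sym (begin
      reverse (ds ++ replicate g fzero ++ [ fsuc fzero ])
    ≡⟨ cong reverse (sym (++-assoc ds (replicate g fzero) [ fsuc fzero ])) ⟩
      reverse ((ds ++ replicate g fzero) ++ [ fsuc fzero ])
    ≡⟨ reverse-++ (ds ++ replicate g fzero) [ fsuc fzero ] ⟩
      fsuc fzero ∷ reverse (ds ++ replicate g fzero) ∎)) λ ()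
    where open ≡-Reasoning

  module Digits {C : ℕ} (U₀≡1 : U 0 ≡ 1) (bounded : ∀ i → U (suc i) ≤ C * U i)
                .{{_ : ∀ {i} → NonZero (U i)}} where

    greedy-digits : ∀ ℓ n → n < U ℓ →
                    Σ (List (Fin C)) λ ds → (length ds ≡ ℓ) × (valFrom U 0 ds ≡ n) × GreedyFrom 0 0 ds
    greedy-digits zero zero _ = [] , refl , refl , tt
    greedy-digits zero (suc n) n<U₀ with s≤s () ← subst (suc n <_) U₀≡1 n<U₀
    greedy-digits (suc ℓ) n n<U with greedy-digits ℓ (n % U ℓ) (m%n<n n (U ℓ))
    ... | ds , len-ds , val-ds , greedy-ds = ds ++ [ d ] , length-ok , value-ok , greedyFrom-++ 0 0 ds [ d ] greedy-ds greedy-d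
      where
      d/U<C : n / U ℓ < C
      d/U<C = m<n*o⇒m/o<n (<-≤-trans n<U (bounded ℓ))
      d : Fin C
      d = fromℕ< d/U<C
      n≡ : n % U ℓ + toℕ d * U ℓ ≡ n
      n≡ = trans (cong (λ x → n % U ℓ + x * U ℓ) (toℕ-fromℕ< d/U<C)) (sym (m≡m%n+[m/n]*n n (U ℓ)))
      length-ok : length (ds ++ [ d ]) ≡ suc ℓ
      length-ok = trans (length-++ ds) (trans (+-comm (length ds) 1) (cong suc len-ds))
      value-ok : valFrom U 0 (ds ++ [ d ]) ≡ n
      value-ok = trans (valFrom-++ 0 ds [ d ])
        (trans (cong₂ (λ v j → v + (toℕ d * U j + 0)) val-ds len-ds) (trans (cong (_+_ (n % U ℓ)) (+-identityʳ _)) n≡))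
      greedy-d : GreedyFrom (0 + length ds) (0 + valFrom U 0 ds) [ d ]
      greedy-d = subst₂ (λ j v → GreedyFrom j v [ d ]) (sym len-ds) (sym val-ds) (subst (_< U (suc ℓ)) (sym n≡) n<U , tt)

true⇔true⇒≡ : ∀ {x y : Bool} → (x ≡ true → y ≡ true) → (y ≡ true → x ≡ true) → x ≡ y
true⇔true⇒≡ {true} x⇒y _ = sym (x⇒y refl)
true⇔true⇒≡ {false} {false} _ _ = refl
true⇔true⇒≡ {false} {true} _ y⇒x = y⇒x refl

NerodeEquivalent : ∀ {C} → (List (Fin C) → Set) → List (Fin C) → List (Fin C) → Set
NerodeEquivalent L u v = ∀ w → (L (u ++ w) → L (v ++ w)) × (L (v ++ w) → L (u ++ w))

module _ {C : ℕ} (M : DFA C) where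
  open DFA M

  run-++ : ∀ s (u v : List (Fin C)) → run s (u ++ v) ≡ run (run s u) v
  run-++ s [] v = refl
  run-++ s (x ∷ u) v = run-++ (δ s x) u v

  same-state⇒nerodeEquivalent : ∀ {L} → Recognizes M L → ∀ {u v} → run start u ≡ run start v →
                                NerodeEquivalent L u v
  same-state⇒nerodeEquivalent {L} recognizes {u} {v} same w = transport u v same , transport v u (sym same)
    where
    transport : ∀ x y → run start x ≡ run start y → L (x ++ w) → L (y ++ w)
    transport x y eq x∈L = proj₁ (recognizes (y ++ w)) (begin
        final (run start (y ++ w))      ≡⟨ cong final (trans (run-++ start y w) (cong (λ s → run s w) (sym eq))) ⟩
        final (run (run start x) w)     ≡⟨ cong final (sym (run-++ start x w)) ⟩
        final (run start (x ++ w))      ≡⟨ proj₂ (recognizes (x ++ w)) x∈L ⟩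
        true ∎)
      where open ≡-Reasoning

  inequivalent⇒≤states : ∀ {L} → Recognizes M L → ∀ m (u : ℕ → List (Fin C)) →
                         (∀ i j → i < j → j < m → ¬ NerodeEquivalent L (u i) (u j)) → m ≤ states
  inequivalent⇒≤states recognizes m u inequivalent with m ≤? states
  ... | yes m≤states = m≤states
  ... | no m≰states with pigeonhole (≰⇒> m≰states) (λ x → run start (u (toℕ x)))
  ... | i , j , i<j , same =
    contradiction (same-state⇒nerodeEquivalent recognizes same) (inequivalent (toℕ i) (toℕ j) i<j (toℕ<n j))

module Construction
  {U : ℕ → ℕ} (numsys : IsNumSys U) {C : ℕ} (bounded : ∀ i → U (suc i) ≤ suc (suc C) * U i)
  (π : ℕ) (gaps-≥ : ∀ D → ∃[ B ] ∀ i → B ≤ i → D ≤ U (suc i) ∸ U i)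
  (i* T : ℕ) (1≤T : 1 ≤ T) (M₀ : ℕ) where

  open Greedy U

  B : ℕ → ℕ
  B D = proj₁ (gaps-≥ D)

  instance
    U≢0 : ∀ {i} → NonZero (U i)
    U≢0 {i} = >-nonZero (≤-<-trans z≤n (i<U[i] numsys i))

  open Digits {suc (suc C)} (proj₁ numsys) bounded

  -- The 1 closing block c sits at pos c ∈ i* + Tℕ, so U (pos c) ≡ U i* (mod q); pos c ≥ B (π + value c)
  -- keeps all words greedy, and pos c ≥ M₀ puts their values in the periodic part of X.
  mutual
    first : ℕ → ℕ
    first zero = π
    first (suc c) = suc (pos c)

    value : ℕ → ℕ
    value zero = 0
    value (suc c) = value c + U (pos c)

    pos : ℕ → ℕ
    pos c = i* + T * (first c + B (π + value c) + M₀)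

  gap : ℕ → ℕ
  gap c = pos c ∸ first c

  high : ℕ → List (Fin (suc (suc C)))
  high zero = []
  high (suc c) = high c ++ block (gap c)

  bound≤pos : ∀ c → first c + B (π + value c) + M₀ ≤ pos c
  bound≤pos c = ≤-trans (m≤n*m _ T {{>-nonZero 1≤T}}) (m≤n+m _ i*)

  first≤pos : ∀ c → first c ≤ pos c
  first≤pos c = ≤-trans (≤-trans (m≤m+n _ _) (m≤m+n _ M₀)) (bound≤pos c)

  first+gap : ∀ c → first c + gap c ≡ pos c
  first+gap c = m+[n∸m]≡n (first≤pos c)

  π+length-high : ∀ c → π + length (high c) ≡ first c
  π+length-high zero = +-identityʳ π
  π+length-high (suc c) = begin
      π + length (high c ++ block (gap c))
    ≡⟨ cong (_+_ π) (length-++ (high c)) ⟩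
      π + (length (high c) + length (block {C} (gap c)))
    ≡⟨ sym (+-assoc π _ _) ⟩
      π + length (high c) + length (block {C} (gap c))
    ≡⟨ cong₂ _+_ (π+length-high c) (length-block (gap c)) ⟩
      first c + suc (gap c)
    ≡⟨ +-suc (first c) (gap c) ⟩
      suc (first c + gap c)
    ≡⟨ cong suc (first+gap c) ⟩
      suc (pos c) ∎
    where open ≡-Reasoning

  valFrom-high : ∀ c → valFrom U π (high c) ≡ value c
  valFrom-high zero = refl
  valFrom-high (suc c) = begin
      valFrom U π (high c ++ block (gap c))
    ≡⟨ valFrom-++ π (high c) (block (gap c)) ⟩
      valFrom U π (high c) + valFrom U (π + length (high c)) (block (gap c))
    ≡⟨ cong₂ (λ v i → v + valFrom U i (block {C} (gap c))) (valFrom-high c) (π+length-high c) ⟩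
      value c + valFrom U (first c) (block {C} (gap c))
    ≡⟨ cong (_+_ (value c)) (trans (valFrom-block (first c) (gap c)) (cong U (first+gap c))) ⟩
      value c + U (pos c) ∎
    where open ≡-Reasoning

  +U[pos]<U[suc-pos] : ∀ c {s} → s < π + value c → s + U (pos c) < U (suc (pos c))
  +U[pos]<U[suc-pos] c {s} s< = <-≤-trans (+-monoˡ-< (U (pos c)) s<)
    (≤-trans (+-monoˡ-≤ (U (pos c)) (proj₂ (gaps-≥ (π + value c)) (pos c) B≤pos))
      (≤-reflexive (m∸n+n≡m (<⇒≤ (proj₂ numsys (pos c))))))
    where
    B≤pos : B (π + value c) ≤ pos c
    B≤pos = ≤-trans (≤-trans (m≤n+m _ (first c)) (m≤m+n _ M₀)) (bound≤pos c)

  greedyFrom-high : ∀ c {t} → t < π → GreedyFrom π t (high c) × t + value c < U (first c)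
  greedyFrom-high zero {t} t<π = tt , subst (_< U π) (sym (+-identityʳ t)) (<-trans t<π (i<U[i] numsys π))
  greedyFrom-high (suc c) {t} t<π with greedyFrom-high c t<π
  ... | greedy , below = greedyFrom-++ π t (high c) (block (gap c)) greedy
        (subst₂ (λ i s → GreedyFrom i s (block {C} (gap c))) (sym (π+length-high c)) (cong (_+_ t) (sym (valFrom-high c)))
          (greedyFrom-block (proj₂ numsys) (first c) (t + value c) (gap c) below
            (subst (λ i → t + value c + U i < U (suc i)) (sym (first+gap c)) top))) ,
        subst (_< U (suc (pos c))) (+-assoc t (value c) _) top
    where
    top : t + value c + U (pos c) < U (suc (pos c))
    top = +U[pos]<U[suc-pos] c (+-monoˡ-< (value c) t<π)

  low : ∀ {t} → t < π → List (Fin (suc (suc C)))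
  low t<π = proj₁ (greedy-digits π _ (<-trans t<π (i<U[i] numsys π)))

  word : ∀ c {t} → t < π → List (Fin (suc (suc C)))
  word c t<π = reverse (low t<π ++ high c)

  word≡ : ∀ c {t} (t<π : t < π) → word c t<π ≡ reverse (high c) ++ reverse (low t<π)
  word≡ c t<π = reverse-++ (low t<π) (high c)

  val-word : ∀ c {t} (t<π : t < π) → val U (word c t<π) ≡ value c + t
  val-word c {t} t<π with greedy-digits π t (<-trans t<π (i<U[i] numsys π))
  ... | ds , length-ds , val-ds , _ = begin
      valFrom U 0 (reverse (reverse (ds ++ high c)))
    ≡⟨ cong (valFrom U 0) (reverse-involutive (ds ++ high c)) ⟩
      valFrom U 0 (ds ++ high c)
    ≡⟨ valFrom-++ 0 ds (high c) ⟩
      valFrom U 0 ds + valFrom U (length ds) (high c)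
    ≡⟨ cong₂ (λ v i → v + valFrom U i (high c)) val-ds length-ds ⟩
      t + valFrom U π (high c)
    ≡⟨ cong (_+_ t) (valFrom-high c) ⟩
      t + value c
    ≡⟨ +-comm t (value c) ⟩
      value c + t ∎
    where open ≡-Reasoning

  word∈RepLang : ∀ X c {t} (t<π : t < π) → X (value (suc c) + t) ≡ true →
                 RepLang (suc (suc C)) U X (word (suc c) t<π)
  word∈RepLang X c {t} t<π x∈X with greedy-digits π t (<-trans t<π (i<U[i] numsys π)) | val-word (suc c) t<π
  ... | ds , length-ds , val-ds , greedy-ds | value-ok =
    value (suc c) + t , x∈X , value-ok ,
    subst LeadingNonzero (cong reverse (++-assoc ds (high c) _)) (leadingNonzero-block (ds ++ high c) (gap c)) ,
    greedyFrom⇒Greedy (ds ++ high (suc c)) (greedyFrom-++ 0 0 ds (high (suc c)) greedy-ds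
      (subst₂ (λ i s → GreedyFrom i s (high (suc c))) (sym length-ds) (sym val-ds) (proj₁ (greedyFrom-high (suc c) t<π))))

  RepLang-word⇒∈ : ∀ X c {t} (t<π : t < π) → RepLang (suc (suc C)) U X (word c t<π) → X (value c + t) ≡ true
  RepLang-word⇒∈ X c t<π (n , n∈X , val≡n , _) = subst (λ x → X x ≡ true) (trans (sym val≡n) (val-word c t<π)) n∈X

  M₀≤value : ∀ c → M₀ ≤ value (suc c)
  M₀≤value c = ≤-trans (≤-trans (m≤n+m M₀ _) (bound≤pos c))
    (≤-trans (<⇒≤ (i<U[i] numsys (pos c))) (m≤n+m _ (value c)))

  value-≤ : ∀ {c c'} → c ≤ c' → value c ≤ value c'
  value-≤ = monotoneFrom-≤ {G = 0} (λ c _ → m≤m+n (value c) _) z≤n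

  value-≡-mod : ∀ {q} → (∀ m → + U (i* + T * m) ≡ + U i* [mod q ]) → ∀ c → + value c ≡ + (c * U i*) [mod q ]
  value-≡-mod periodic zero = ≡-mod-refl
  value-≡-mod {q} periodic (suc c) = subst₂ _≡_[mod q ] (sym (ℤ.pos-+ (value c) (U (pos c))))
    (trans (sym (ℤ.pos-+ (c * U i*) (U i*))) (cong +_ (+-comm _ (U i*))))
    (+-cong-mod (value-≡-mod periodic c) (periodic _))

module LowerBound
  {U : ℕ → ℕ} (numsys : IsNumSys U) {C : ℕ} (bounded : ∀ i → U (suc i) ≤ suc (suc C) * U i)
  (gaps-≥ : ∀ D → ∃[ B ] ∀ i → B ≤ i → D ≤ U (suc i) ∸ U i)
  {X : ℕ → Bool} {π : ℕ} (hasPeriod : HasPeriod X π)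
  {p : ℕ} (p-prime : Prime p) (μ : ℕ) (p^μ∣π : p ^ μ ∣ π)
  (i* T : ℕ) (1≤T : 1 ≤ T) (p∤U[i*] : ¬ p ∣ U i*)
  (periodic-mod : ∀ m → + U (i* + T * m) ≡ + U i* [mod p ^ μ ])
  where

  M₀ : ℕ
  M₀ = proj₁ (proj₂ (proj₁ hasPeriod))

  open Construction numsys {C} bounded π gaps-≥ i* T 1≤T M₀

  private
    q = p ^ μ
    u = U i*
    L = RepLang (suc (suc C)) U X

  prefix : ℕ → List (Fin (suc (suc C)))
  prefix c = reverse (high (suc c))

  nerodeEquivalent⇒∈ : ∀ {c c'} → NerodeEquivalent L (prefix c) (prefix c') →
                       ∀ {t} (t<π : t < π) → X (value (suc c) + t) ≡ true → X (value (suc c') + t) ≡ true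
  nerodeEquivalent⇒∈ {c} {c'} equivalent t<π t∈X = RepLang-word⇒∈ X (suc c') t<π
    (subst L (sym (word≡ (suc c') t<π))
      (proj₁ (equivalent (reverse (low t<π))) (subst L (word≡ (suc c) t<π) (word∈RepLang X c t<π t∈X))))

  nerodeEquivalent⇒agree : ∀ {c c'} → NerodeEquivalent L (prefix c) (prefix c') →
                           ∀ t → X (value (suc c) + t) ≡ X (value (suc c') + t)
  nerodeEquivalent⇒agree {c} {c'} equivalent = agree-below-period⇒agree (proj₂ (proj₂ (proj₁ hasPeriod)))
    {{>-nonZero (proj₁ (proj₁ hasPeriod))}} (M₀≤value c) (M₀≤value c')
    (λ t t<π → true⇔true⇒≡ (nerodeEquivalent⇒∈ equivalent t<π) (nerodeEquivalent⇒∈ (λ w → swap (equivalent w)) t<π))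

  prefixes-inequivalent : ∀ c c' → c < c' → c' < q → ¬ NerodeEquivalent L (prefix c) (prefix c')
  prefixes-inequivalent c c' c<c' c'<q equivalent =
    <⇒≱ (≤-<-trans (m∸n≤m c' c) c'<q) (ℕ∣.∣⇒≤ {{>-nonZero (m<n⇒0<n∸m c<c')}} q∣e)
    where
    a = value (suc c)
    b = value (suc c')
    a≤b : a ≤ b
    a≤b = value-≤ (s≤s (<⇒≤ c<c'))
    d = b ∸ a
    a+d≡b : a + d ≡ b
    a+d≡b = m+[n∸m]≡n a≤b
    q∣d : q ∣ d
    q∣d = ℕ∣.∣-trans p^μ∣π (minimal-period-∣ hasPeriod (shifted-copy⇒periodicFrom a d
      (λ t → trans (nerodeEquivalent⇒agree equivalent t) (cong (λ x → X (x + t)) (sym a+d≡b)))))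
    e = c' ∸ c
    [1+c′]u≡[1+c]u+eu : suc c' * u ≡ suc c * u + e * u
    [1+c′]u≡[1+c]u+eu = trans (cong (_* u) (cong suc (sym (m+[n∸m]≡n (<⇒≤ c<c'))))) (*-distribʳ-+ u (suc c) e)
    b≡a : + b ≡ + a [mod q ]
    b≡a = subst (λ x → + x ≡ + a [mod q ]) a+d≡b (∣⇒+-≡-mod a q∣d)
    residues : + (suc c' * u) ≡ + (suc c * u) [mod q ]
    residues = ≡-mod-trans (≡-mod-sym (value-≡-mod periodic-mod (suc c'))) (≡-mod-trans b≡a (value-≡-mod periodic-mod (suc c)))
    q∣e : q ∣ e
    q∣e = prime^-∣-cancelʳ p-prime μ p∤U[i*]
      (+-≡-mod⇒∣ (suc c * u) (subst (λ x → + x ≡ + (suc c * u) [mod q ]) [1+c′]u≡[1+c]u+eu residues))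

  repLang-lower-bound : MinAutomatonAtLeast L q
  repLang-lower-bound M recognizes = inequivalent⇒≤states M recognizes q prefix prefixes-inequivalent

2≤base : ∀ {U C} → IsNumSys U → (∀ i → U (suc i) ≤ C * U i) → 2 ≤ C
2≤base {U} {C} numsys@(U₀≡1 , _) bounded = *-cancelʳ-≤ 2 C (U 0) (begin
    2 * U 0   ≡⟨ cong (2 *_) U₀≡1 ⟩
    2         ≤⟨ i<U[i] numsys 1 ⟩
    U 1       ≤⟨ bounded 0 ⟩
    C * U 0   ∎)
  where
  open ≤-Reasoning
  instance
    U₀≢0 : NonZero (U 0)
    U₀≢0 = subst NonZero (sym U₀≡1) _

corollary4p6 : (U : ℕ → ℕ) (C : ℕ) → IsNumSys U → IsCU U C →
    (k : ℕ) (a : Fin (suc k) → ℤ) (N : ℕ) → MinLinRec U k a N →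
    H1 C U → H2 U → H3 U →
    (p : ℕ) → Prime p → ∣ a fzero ∣ < p → U N < p →
    (X : ℕ → Bool) (μ r : ℕ) → Recognizable C U X →
    HasPeriod X (p ^ μ * r) → 1 ≤ μ → ¬ (p ∣ r) →
    MinAutomatonAtLeast (RepLang C U X) (p ^ μ)
corollary4p6 U C numsys (bounded , _) k a N (rec , _) _ unbounded monotone p p-prime ∣a₀∣<p U[N]<p X μ r _ hasPeriod _ _ =
  lower-bound bounded (2≤base numsys bounded)
    (Recurrence.nondivisible-periodic-progression {U} {k} {a} {N} rec p-prime ∣a₀∣<p
      (≤-<-trans z≤n (i<U[i] numsys N)) U[N]<p μ)
  where
  lower-bound : ∀ {C} → (∀ i → U (suc i) ≤ C * U i) → 2 ≤ C →
                (∃[ i* ] ∃[ T ] (1 ≤ T) × ¬ p ∣ U i* × (∀ m → + U (i* + T * m) ≡ + U i* [mod p ^ μ ])) →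
                MinAutomatonAtLeast (RepLang C U X) (p ^ μ)
  lower-bound {suc zero} _ (s≤s ())
  lower-bound {suc (suc _)} bounded _ (i* , T , 1≤T , p∤U[i*] , periodic) =
    LowerBound.repLang-lower-bound numsys bounded (gaps-eventually-≥ {U} unbounded monotone) hasPeriod
      p-prime μ (ℕ∣.m∣m*n r) i* T 1≤T p∤U[i*] periodic
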